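{- There is no finite connected simple graph $\Gamma$ with a perfect matching $\mathcal{M} = \{e_i = \{\alpha_i,\beta_i\} : 1 \le i \le m\}$, $m \ge 2$, such that the setwise stabilizer of $\mathcal{M}$ in $\operatorname{Aut}(\Gamma)$ acts $2$-transitively on the edges of $\mathcal{M}$ and the induced subgraph $\Gamma[\alpha_1,\beta_1,\alpha_2,\beta_2]$ is a triangle with a pendant edge.
   Context: $\Gamma[X]$ denotes the subgraph induced on the vertex set $X$. A triangle with a pendant edge is the graph on four vertices consisting of a $3$-cycle together with one further edge joining a vertex of the cycle to the fourth vertex. -}

module Defs where

open import Data.Nat using (ℕ; suc)
open import Data.Fin using (Fin; zero; suc)
open import Data.Bool using (Bool; true; false)
open import Data.Sum using (_⊎_; [_,_])
open import Data.Product using (_×_; ∃; ∃-syntax; Σ)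
open import Data.Fin.Permutation using (Permutation′; _⟨$⟩ʳ_)
open import Relation.Binary.PropositionalEquality using (_≡_; _≢_)
open import Function.Definitions using (Bijective)

record SimpleGraph (n : ℕ) : Set where
  field
    adj     : Fin n → Fin n → Bool
    adj-sym : ∀ u v → adj u v ≡ adj v u
    adj-irr : ∀ v → adj v v ≡ false

open SimpleGraph public

Adj : ∀ {n} → SimpleGraph n → Fin n → Fin n → Set
Adj Γ u v = adj Γ u v ≡ true

data Walk {n} (Γ : SimpleGraph n) : Fin n → Fin n → Set where
  here : ∀ {v} → Walk Γ v v
  step : ∀ {u v w} → Adj Γ u v → Walk Γ v w → Walk Γ u w

Connected : ∀ {n} → SimpleGraph n → Set
Connected {n} Γ = ∀ (u v : Fin n) → Walk Γ u v

-- A perfect matching M = { e_i = {α i , β i} : i ∈ Fin m }: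
-- each e_i is an edge, and every vertex lies in exactly one e_i as
-- exactly one of its endpoints, i.e. [α , β] : Fin m ⊎ Fin m → Fin n
-- is a bijection.
record PerfectMatching {n} (Γ : SimpleGraph n) (m : ℕ) : Set where
  field
    α β       : Fin m → Fin n
    isEdge    : ∀ i → Adj Γ (α i) (β i)
    partition : Bijective _≡_ _≡_ [ α , β ]

open PerfectMatching public

IsAut : ∀ {n} → SimpleGraph n → Permutation′ n → Set
IsAut Γ σ = ∀ u v → adj Γ (σ ⟨$⟩ʳ u) (σ ⟨$⟩ʳ v) ≡ adj Γ u v

MapsEdge : ∀ {n m} {Γ : SimpleGraph n} → PerfectMatching Γ m →
           Permutation′ n → Fin m → Fin m → Set
MapsEdge M σ i j =
  ((σ ⟨$⟩ʳ α M i ≡ α M j) × (σ ⟨$⟩ʳ β M i ≡ β M j)) ⊎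
  ((σ ⟨$⟩ʳ α M i ≡ β M j) × (σ ⟨$⟩ʳ β M i ≡ α M j))

InStabilizer : ∀ {n m} {Γ : SimpleGraph n} → PerfectMatching Γ m →
               Permutation′ n → Set
InStabilizer {Γ = Γ} M σ = IsAut Γ σ × (∀ i → ∃[ j ] MapsEdge M σ i j)

Stab2Transitive : ∀ {n m} {Γ : SimpleGraph n} → PerfectMatching Γ m → Set
Stab2Transitive {m = m} M =
  ∀ (i j k l : Fin m) → i ≢ j → k ≢ l →
  ∃[ σ ] (InStabilizer M σ × MapsEdge M σ i k × MapsEdge M σ j l)

-- the paw: triangle on 0,1,2 with pendant edge 0–3
paw : Fin 4 → Fin 4 → Bool
paw zero (suc zero) = true
paw zero (suc (suc zero)) = true
paw zero (suc (suc (suc zero))) = true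
paw (suc zero) zero = true
paw (suc zero) (suc (suc zero)) = true
paw (suc (suc zero)) zero = true
paw (suc (suc zero)) (suc zero) = true
paw (suc (suc (suc zero))) zero = true
paw _ _ = false

InducesPaw : ∀ {n} → SimpleGraph n → (Fin 4 → Fin n) → Set
InducesPaw Γ v = ∃[ π ] (∀ a b → adj Γ (v (π ⟨$⟩ʳ a)) (v (π ⟨$⟩ʳ b)) ≡ paw a b)

-- the four vertices α₁, β₁, α₂, β₂ (indices 1,2 of the paper are zero, suc zero)
firstFour : ∀ {n k} {Γ : SimpleGraph n} → PerfectMatching Γ (suc (suc k)) →
            Fin 4 → Fin n
firstFour M zero = α M zero
firstFour M (suc zero) = β M zero
firstFour M (suc (suc zero)) = α M (suc zero)
firstFour M (suc (suc (suc zero))) = β M (suc zero)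

-- Take σ in the stabilizer with σ e₁ = e₂ and σ e₂ = e₁. It permutes the four
-- vertices α₁, β₁, α₂, β₂ without fixed points, and restricts to an automorphism
-- of the induced subgraph. Transported along the isomorphism with the triangle
-- with a pendant edge, this is a fixed-point-free automorphism of that graph;
-- but every automorphism fixes its unique vertex of degree 3.
module Submission where

open import Defs
open import Data.Nat using (ℕ; suc)
open import Data.Fin using (Fin; zero; suc)
open import Data.Fin.Properties using (all?; _≟_)
open import Data.Bool using (Bool)
import Data.Bool.Properties as Bool
open import Data.Vec using (_∷_; []; lookup)
open import Data.Vec.Properties using (lookup∘tabulate)
open import Data.Product using (Σ; ∃-syntax; _×_; _,_; proj₁; proj₂)
open import Data.Sum using (inj₁; inj₂)
open import Data.Fin.Permutation using (Permutation′; _⟨$⟩ʳ_; _⟨$⟩ˡ_; inverseʳ)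
open import Function using (_∘_)
open import Relation.Nullary using (¬_; Dec)
open import Relation.Nullary.Decidable using (toWitness; _→-dec_)
open import Relation.Binary.PropositionalEquality

IsAutomorphism : ∀ {n} → (Fin n → Fin n → Bool) → (Fin n → Fin n) → Set
IsAutomorphism R f = ∀ a b → R (f a) (f b) ≡ R a b

isAutomorphism? : ∀ {n} R (f : Fin n → Fin n) → Dec (IsAutomorphism R f)
isAutomorphism? R f = all? λ a → all? λ b → R (f a) (f b) Bool.≟ R a b

IsAutomorphism-resp-≗ : ∀ {n} {R} {f g : Fin n → Fin n} →
  f ≗ g → IsAutomorphism R f → IsAutomorphism R g
IsAutomorphism-resp-≗ {R = R} f≗g aut a b =
  subst₂ (λ x y → R x y ≡ R a b) (f≗g a) (f≗g b) (aut a b)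

conjugate-automorphism : ∀ {n} {R S : Fin n → Fin n → Bool} (π : Permutation′ n) →
  (∀ a b → R (π ⟨$⟩ʳ a) (π ⟨$⟩ʳ b) ≡ S a b) →
  ∀ {f} → IsAutomorphism R f → IsAutomorphism S (λ a → π ⟨$⟩ˡ f (π ⟨$⟩ʳ a))
conjugate-automorphism {R = R} {S} π iso {f} aut a b = begin
  S (π⁻¹fπ a) (π⁻¹fπ b)                            ≡⟨ sym (iso (π⁻¹fπ a) (π⁻¹fπ b)) ⟩
  R (π ⟨$⟩ʳ π⁻¹fπ a) (π ⟨$⟩ʳ π⁻¹fπ b)              ≡⟨ cong₂ R (inverseʳ π) (inverseʳ π) ⟩
  R (f (π ⟨$⟩ʳ a)) (f (π ⟨$⟩ʳ b))                  ≡⟨ aut (π ⟨$⟩ʳ a) (π ⟨$⟩ʳ b) ⟩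
  R (π ⟨$⟩ʳ a) (π ⟨$⟩ʳ b)                          ≡⟨ iso a b ⟩
  S a b                                            ∎
  where
  open ≡-Reasoning
  π⁻¹fπ : Fin _ → Fin _
  π⁻¹fπ a = π ⟨$⟩ˡ f (π ⟨$⟩ʳ a)

restrict-automorphism : ∀ {n m} {Γ : SimpleGraph n} {σ : Permutation′ n}
  (v : Fin m → Fin n) {τ : Fin m → Fin m} →
  IsAut Γ σ → (∀ a → σ ⟨$⟩ʳ v a ≡ v (τ a)) →
  IsAutomorphism (λ a b → adj Γ (v a) (v b)) τ
restrict-automorphism {Γ = Γ} v aut στ a b =
  subst₂ (λ x y → adj Γ x y ≡ adj Γ (v a) (v b)) (στ a) (στ b) (aut (v a) (v b))

-- Exhaustive check over all 4⁴ maps, given by their value tables.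
paw-tabulated-automorphism-fixes-hub : ∀ x y z w →
  IsAutomorphism paw (lookup (x ∷ y ∷ z ∷ w ∷ [])) → x ≡ zero
paw-tabulated-automorphism-fixes-hub = toWitness {a? = decision} _
  where
  decision = all? λ x → all? λ y → all? λ z → all? λ w →
    isAutomorphism? paw (lookup (x ∷ y ∷ z ∷ w ∷ [])) →-dec (x ≟ zero)

paw-automorphism-fixes-hub : ∀ {f} → IsAutomorphism paw f → f zero ≡ zero
paw-automorphism-fixes-hub {f} aut =
  paw-tabulated-automorphism-fixes-hub (f zero) _ _ _
    (IsAutomorphism-resp-≗ (sym ∘ lookup∘tabulate f) aut)

swap-moves-firstFour : ∀ {n k} {Γ : SimpleGraph n} (M : PerfectMatching Γ (suc (suc k)))
  {σ} → MapsEdge M σ zero (suc zero) → MapsEdge M σ (suc zero) zero →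
  ∀ a → ∃[ b ] (a ≢ b × σ ⟨$⟩ʳ firstFour M a ≡ firstFour M b)
swap-moves-firstFour M (inj₁ (p , _)) _ zero = suc (suc zero) , (λ ()) , p
swap-moves-firstFour M (inj₂ (p , _)) _ zero = suc (suc (suc zero)) , (λ ()) , p
swap-moves-firstFour M (inj₁ (_ , q)) _ (suc zero) = suc (suc (suc zero)) , (λ ()) , q
swap-moves-firstFour M (inj₂ (_ , q)) _ (suc zero) = suc (suc zero) , (λ ()) , q
swap-moves-firstFour M _ (inj₁ (p , _)) (suc (suc zero)) = zero , (λ ()) , p
swap-moves-firstFour M _ (inj₂ (p , _)) (suc (suc zero)) = suc zero , (λ ()) , p
swap-moves-firstFour M _ (inj₁ (_ , q)) (suc (suc (suc zero))) = suc zero , (λ ()) , q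
swap-moves-firstFour M _ (inj₂ (_ , q)) (suc (suc (suc zero))) = zero , (λ ()) , q

lemma6p5 : (n k : ℕ) (Γ : SimpleGraph n) →
    ¬ (Connected Γ × Σ (PerfectMatching Γ (suc (suc k))) (λ M →
        Stab2Transitive M × InducesPaw Γ (firstFour M)))
lemma6p5 n k Γ (_ , M , stab2 , π , iso)
  with stab2 zero (suc zero) (suc zero) zero (λ ()) (λ ())
... | σ , (aut , _) , e₁↦e₂ , e₂↦e₁ = τ-moves hub τ-fixes-hub
  where
  moves : ∀ a → ∃[ b ] (a ≢ b × σ ⟨$⟩ʳ firstFour M a ≡ firstFour M b)
  moves = swap-moves-firstFour M {σ} e₁↦e₂ e₂↦e₁
  τ : Fin 4 → Fin 4
  τ a = proj₁ (moves a)
  τ-moves : ∀ a → a ≢ τ a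
  τ-moves a = proj₁ (proj₂ (moves a))
  hub : Fin 4
  hub = π ⟨$⟩ʳ zero
  π⁻¹τπ-fixes-hub : π ⟨$⟩ˡ τ hub ≡ zero
  π⁻¹τπ-fixes-hub = paw-automorphism-fixes-hub
    (conjugate-automorphism π iso {τ}
      (restrict-automorphism {Γ = Γ} {σ} (firstFour M) {τ} aut (proj₂ ∘ proj₂ ∘ moves)))
  τ-fixes-hub : hub ≡ τ hub
  τ-fixes-hub = trans (cong (π ⟨$⟩ʳ_) (sym π⁻¹τπ-fixes-hub)) (inverseʳ π)
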